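{- Let $\mathbb{A}$ be an epistemic Heyting algebra and $a\in\mathbb{A}$. If $b\in\mathsf{Min}_i(\mathbb{A})$ and $b\wedge a\neq\bot$, then $[b]\in\mathsf{Min}_i(\mathbb{A}^a)$.
   Context: A monadic Heyting algebra is $\langle\mathbb{L},(\lozenge_i),(\Box_i)\rangle$ with $\mathbb{L}$ a Heyting algebra and monotone unary $\lozenge_i,\Box_i$ such that for all $a,b$: $a\le\lozenge_ia$; $\Box_ia\le a$; $\lozenge_i(a\vee b)\le\lozenge_ia\vee\lozenge_ib$; $\Box_i(a\to b)\le\Box_ia\to\Box_ib$; $\lozenge_ia\le\Box_i\lozenge_ia$; $\lozenge_i\Box_ia\le\Box_ia$; $\Box_i(a\to b)\le\lozenge_ia\to\lozenge_ib$; $\lozenge_i\bot\le\bot$; $\top\le\Box_i\top$. An epistemic Heyting algebra is a finite monadic Heyting algebra with $\lozenge_ia\vee\neg\lozenge_ia=\top$. An element $c$ of such an algebra is $i$-minimal if $c\neq\bot$, $\lozenge_ic=c$, and whenever $d<c$ and $\lozenge_id=d$ then $d=\bot$; $\mathsf{Min}_i(\cdot)$ is the set of $i$-minimal elements. The pseudo-quotient $\mathbb{A}^a=(\mathbb{L}/{\cong_a},(\lozenge^a_i),(\Box^a_i))$: $b\cong_ac$ iff $b\wedge a=c\wedge a$, $[c]$ is the class of $c$, the Heyting operations are induced, $\lozenge^a_i[b]=[\lozenge_i(b\wedge a)]$, $\Box^a_i[b]=[\Box_i(a\to b)]$. -}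

module Defs where

open import Level using (Level; _⊔_) renaming (suc to lsuc)
open import Data.Nat using (ℕ)
open import Data.Fin using (Fin)
open import Data.Product using (Σ; _×_)
open import Relation.Nullary using (¬_)
open import Relation.Binary using (Rel)
open import Relation.Binary.Lattice.Bundles using (HeytingAlgebra)

record IsMonadic {c ℓ₁ ℓ₂ : Level} (H : HeytingAlgebra c ℓ₁ ℓ₂) (I : Set)
                 (◇ □ : I → HeytingAlgebra.Carrier H → HeytingAlgebra.Carrier H)
                 : Set (c ⊔ ℓ₁ ⊔ ℓ₂) where
  open HeytingAlgebra H
  field
    ◇-mono  : ∀ i {a b} → a ≤ b → ◇ i a ≤ ◇ i b
    □-mono  : ∀ i {a b} → a ≤ b → □ i a ≤ □ i b
    ax1 : ∀ i a → a ≤ ◇ i a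
    ax2 : ∀ i a → □ i a ≤ a
    ax3 : ∀ i a b → ◇ i (a ∨ b) ≤ ◇ i a ∨ ◇ i b
    ax4 : ∀ i a b → □ i (a ⇨ b) ≤ (□ i a ⇨ □ i b)
    ax5 : ∀ i a → ◇ i a ≤ □ i (◇ i a)
    ax6 : ∀ i a → ◇ i (□ i a) ≤ □ i a
    ax7 : ∀ i a b → □ i (a ⇨ b) ≤ (◇ i a ⇨ ◇ i b)
    ax8 : ∀ i → ◇ i ⊥ ≤ ⊥
    ax9 : ∀ i → ⊤ ≤ □ i ⊤

IsFinite : {c ℓ₁ ℓ₂ : Level} → HeytingAlgebra c ℓ₁ ℓ₂ → Set (c ⊔ ℓ₁)
IsFinite H = Σ ℕ λ n → Σ (Fin n → Carrier) λ f → ∀ x → Σ (Fin n) λ k → f k ≈ x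
  where open HeytingAlgebra H

record EpistemicHeytingAlgebra (c ℓ₁ ℓ₂ : Level) (I : Set) : Set (lsuc (c ⊔ ℓ₁ ⊔ ℓ₂)) where
  field
    heyting   : HeytingAlgebra c ℓ₁ ℓ₂
  open HeytingAlgebra heyting public
  field
    ◇ □       : I → Carrier → Carrier
    isMonadic : IsMonadic heyting I ◇ □
    finite    : IsFinite heyting
    epistemic : ∀ i a → (◇ i a ∨ (◇ i a ⇨ ⊥)) ≈ ⊤

-- This is all that is needed to speak about i-minimal elements, and it lets us
-- present the pseudo-quotient without quotient types.
record Signature (c ℓ₁ ℓ₂ : Level) (I : Set) : Set (lsuc (c ⊔ ℓ₁ ⊔ ℓ₂)) where
  field
    Carrier : Set c
    _≈_     : Rel Carrier ℓ₁
    _≤_     : Rel Carrier ℓ₂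
    _∧_ _∨_ _⇨_ : Carrier → Carrier → Carrier
    ⊤ ⊥     : Carrier
    ◇ □     : I → Carrier → Carrier

Min : {c ℓ₁ ℓ₂ : Level} {I : Set} (S : Signature c ℓ₁ ℓ₂ I) → I →
      Signature.Carrier S → Set (c ⊔ ℓ₁ ⊔ ℓ₂)
Min S i x =
  (¬ (x ≈ ⊥)) × (◇ i x ≈ x) ×
  (∀ d → (d ≤ x × ¬ (d ≈ x)) → ◇ i d ≈ d → d ≈ ⊥)
  where open Signature S

sig : {c ℓ₁ ℓ₂ : Level} {I : Set} → EpistemicHeytingAlgebra c ℓ₁ ℓ₂ I → Signature c ℓ₁ ℓ₂ I
sig A = record
  { Carrier = Carrier ; _≈_ = _≈_ ; _≤_ = _≤_
  ; _∧_ = _∧_ ; _∨_ = _∨_ ; _⇨_ = _⇨_ ; ⊤ = ⊤ ; ⊥ = ⊥ ; ◇ = ◇ ; □ = □ }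
  where open EpistemicHeytingAlgebra A

-- The pseudo-quotient 𝔸ᵃ, presented on representatives: the class [b] is
-- represented by b, with b ≅ₐ c iff b ∧ a = c ∧ a; the Heyting operations are the
-- induced ones (computed on representatives), the induced order is
-- [b] ≤ [c] iff b ∧ a ≤ c ∧ a, and ◇ᵃᵢ[b] = [◇ᵢ(b ∧ a)], □ᵃᵢ[b] = [□ᵢ(a → b)].
pseudoQuotient : {c ℓ₁ ℓ₂ : Level} {I : Set} → (A : EpistemicHeytingAlgebra c ℓ₁ ℓ₂ I) →
                 EpistemicHeytingAlgebra.Carrier A → Signature c ℓ₁ ℓ₂ I
pseudoQuotient A a = record
  { Carrier = Carrier
  ; _≈_ = λ b c → (b ∧ a) ≈ (c ∧ a)
  ; _≤_ = λ b c → (b ∧ a) ≤ (c ∧ a)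
  ; _∧_ = _∧_ ; _∨_ = _∨_ ; _⇨_ = _⇨_ ; ⊤ = ⊤ ; ⊥ = ⊥
  ; ◇ = λ i b → ◇ i (b ∧ a)
  ; □ = λ i b → □ i (a ⇨ b) }
  where open EpistemicHeytingAlgebra A

-- Below an i-minimal element b the closure ◇ᵢ is all-or-nothing: for x ≤ b, ◇ᵢ x is
-- ◇ᵢ-fixed and below b, so either x = ⊥ or ◇ᵢ x = b.  Constructively, the second
-- alternative comes from the epistemic law: b ∧ ¬◇ᵢ x is ◇ᵢ-fixed (by Frobenius) and
-- differs from b when x ≠ ⊥, hence is ⊥, so b ≤ ◇ᵢ x ∨ ¬◇ᵢ x forces b ≤ ◇ᵢ x.
-- In 𝔸ᵃ, [b] is ◇ᵃᵢ-fixed since ◇ᵢ(b ∧ a) = b, and a ◇ᵃᵢ-fixed [d] < [b] has d ∧ a ≤ b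
-- with closure ≠ b, so d ∧ a = ⊥.
module Submission where

open import Defs
open import Level using (Level)
open import Relation.Nullary using (¬_)
open import Data.Product using (_,_; _×_)
open import Relation.Binary.Lattice.Bundles using (HeytingAlgebra)
import Relation.Binary.Lattice.Properties.HeytingAlgebra as HeytingProperties
import Relation.Binary.Lattice.Properties.MeetSemilattice as MeetProperties
import Relation.Binary.Lattice.Properties.BoundedLattice as BoundedProperties

module MonadicProperties
  {c ℓ₁ ℓ₂ : Level} {H : HeytingAlgebra c ℓ₁ ℓ₂} {I : Set}
  {◇ □ : I → HeytingAlgebra.Carrier H → HeytingAlgebra.Carrier H}
  (M : IsMonadic H I ◇ □) where

  open HeytingAlgebra H
  open IsMonadic M
  open HeytingProperties H using (⇨-eval; swap-transpose-⇨)

  ◇-idempotent : ∀ i x → ◇ i (◇ i x) ≈ ◇ i x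
  ◇-idempotent i x =
    antisym (trans (◇-mono i (ax5 i x)) (trans (ax6 i _) (ax2 i _))) (ax1 i _)

  ◇-frobenius : ∀ i x y → ◇ i x ∧ ◇ i y ≤ ◇ i (y ∧ ◇ i x)
  ◇-frobenius i x y = transpose-∧ (trans (ax5 i x) (trans □-pairing (ax7 i y _)))
    where
    □-pairing : □ i (◇ i x) ≤ □ i (y ⇨ y ∧ ◇ i x)
    □-pairing = □-mono i (transpose-⇨ (∧-greatest (x∧y≤y _ _) (x∧y≤x _ _)))

  ◇-¬◇-fixed : ∀ i x → ◇ i (◇ i x ⇨ ⊥) ≈ (◇ i x ⇨ ⊥)
  ◇-¬◇-fixed i x = antisym (swap-transpose-⇨ ◇x∧◇¬◇x≤⊥) (ax1 i _)
    where
    ◇x∧◇¬◇x≤⊥ : ◇ i x ∧ ◇ i (◇ i x ⇨ ⊥) ≤ ⊥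
    ◇x∧◇¬◇x≤⊥ = trans (◇-frobenius i x _) (trans (◇-mono i ⇨-eval) (ax8 i))

  ◇-∧-fixed : ∀ i {u v} → ◇ i u ≈ u → ◇ i v ≈ v → ◇ i (u ∧ v) ≈ u ∧ v
  ◇-∧-fixed i ◇u≈u ◇v≈v = antisym
    (∧-greatest (trans (◇-mono i (x∧y≤x _ _)) (reflexive ◇u≈u))
                (trans (◇-mono i (x∧y≤y _ _)) (reflexive ◇v≈v)))
    (ax1 i _)

module MinimalProperties {c ℓ₁ ℓ₂ : Level} {I : Set} (A : EpistemicHeytingAlgebra c ℓ₁ ℓ₂ I) where

  open EpistemicHeytingAlgebra A
  open IsMonadic isMonadic
  open MonadicProperties isMonadic
  open HeytingProperties heyting using (y≤x⇨y)

  ≤⊥⇒≈⊥ : ∀ {x} → x ≤ ⊥ → x ≈ ⊥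
  ≤⊥⇒≈⊥ x≤⊥ = antisym x≤⊥ (minimum _)

  module _ {i : I} {b : Carrier} (min-b : Min (sig A) i b) where

    private
      ◇b≈b = let _ , p , _ = min-b in p
      minimal = let _ , _ , p = min-b in p

    ◇-below-minimal : ∀ {x} → x ≤ b → ◇ i x ≤ b
    ◇-below-minimal x≤b = trans (◇-mono i x≤b) (reflexive ◇b≈b)

    minimal-◇≉⇒≈⊥ : ∀ {x} → x ≤ b → ¬ (◇ i x ≈ b) → x ≈ ⊥
    minimal-◇≉⇒≈⊥ {x} x≤b ◇x≉b = ≤⊥⇒≈⊥ (trans (ax1 i x) (reflexive ◇x≈⊥))
      where
      ◇x≈⊥ : ◇ i x ≈ ⊥
      ◇x≈⊥ = minimal (◇ i x) (◇-below-minimal x≤b , ◇x≉b) (◇-idempotent i x)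

    minimal-≉⊥⇒◇≈ : ∀ {x} → x ≤ b → ¬ (x ≈ ⊥) → ◇ i x ≈ b
    minimal-≉⊥⇒◇≈ {x} x≤b x≉⊥ = antisym (◇-below-minimal x≤b) b≤◇x
      where
      rest = b ∧ (◇ i x ⇨ ⊥)

      rest≉b : ¬ (rest ≈ b)
      rest≉b rest≈b = x≉⊥ (≤⊥⇒≈⊥ (trans (∧-greatest refl (ax1 i x)) (transpose-∧ x≤¬◇x)))
        where
        x≤¬◇x : x ≤ ◇ i x ⇨ ⊥
        x≤¬◇x = trans x≤b (trans (reflexive (Eq.sym rest≈b)) (x∧y≤y _ _))

      rest≈⊥ : rest ≈ ⊥
      rest≈⊥ = minimal rest (x∧y≤x _ _ , rest≉b) (◇-∧-fixed i ◇b≈b (◇-¬◇-fixed i x))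

      ¬◇x≤b⇨◇x : (◇ i x ⇨ ⊥) ≤ (b ⇨ ◇ i x)
      ¬◇x≤b⇨◇x = transpose-⇨
        (trans (∧-greatest (x∧y≤y _ _) (x∧y≤x _ _)) (trans (reflexive rest≈⊥) (minimum _)))

      b≤◇x : b ≤ ◇ i x
      b≤◇x = trans (∧-greatest (trans (maximum b) (reflexive (Eq.sym (epistemic i x)))) refl)
                   (transpose-∧ (∨-least y≤x⇨y ¬◇x≤b⇨◇x))

lemma4 : {c ℓ₁ ℓ₂ : Level} {I : Set} (A : EpistemicHeytingAlgebra c ℓ₁ ℓ₂ I)
    (a b : EpistemicHeytingAlgebra.Carrier A) (i : I) →
    Min (sig A) i b →
    ¬ (EpistemicHeytingAlgebra._≈_ A (EpistemicHeytingAlgebra._∧_ A b a)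
    (EpistemicHeytingAlgebra.⊥ A)) →
    Min (pseudoQuotient A a) i b
lemma4 A a b i min-b b∧a≉⊥ = [b]≉[⊥] , ◇ᵃ[b]≈[b] , minimalᵃ
  where
  open EpistemicHeytingAlgebra A
  open MinimalProperties A
  open MeetProperties meetSemilattice using (∧-cong)
  open BoundedProperties boundedLattice using (∧-zeroˡ)

  [b]≉[⊥] : ¬ (b ∧ a ≈ ⊥ ∧ a)
  [b]≉[⊥] eq = b∧a≉⊥ (Eq.trans eq (∧-zeroˡ a))

  ◇ᵃ[b]≈[b] : ◇ i (b ∧ a) ∧ a ≈ b ∧ a
  ◇ᵃ[b]≈[b] = ∧-cong (minimal-≉⊥⇒◇≈ min-b (x∧y≤x _ _) b∧a≉⊥) Eq.refl

  minimalᵃ : ∀ d → (d ∧ a ≤ b ∧ a × ¬ (d ∧ a ≈ b ∧ a)) →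
             ◇ i (d ∧ a) ∧ a ≈ d ∧ a → d ∧ a ≈ ⊥ ∧ a
  minimalᵃ d (d∧a≤b∧a , [d]≉[b]) ◇ᵃ[d]≈[d] =
    Eq.trans (minimal-◇≉⇒≈⊥ min-b (trans d∧a≤b∧a (x∧y≤x _ _)) ◇≉b) (Eq.sym (∧-zeroˡ a))
    where
    ◇≉b : ¬ (◇ i (d ∧ a) ≈ b)
    ◇≉b eq = [d]≉[b] (Eq.trans (Eq.sym ◇ᵃ[d]≈[d]) (∧-cong eq Eq.refl))
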